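{- If $G$ is a singleton-partition graph of order $n$ with $\delta(G)=2$ that contains no full vertex, then $L_{\rm SCC}(G)=\infty$ or $L_{\rm SCC}(G)\le 5$.
   Context: All graphs are finite and simple. A full vertex is a vertex adjacent to all other vertices. A set $D\subseteq V$ is dominating if every vertex not in $D$ has a neighbor in $D$. Two disjoint sets $A,B\subseteq V$ form a coalition if neither is dominating but $A\cup B$ is. A coalition partition of $G$ is a partition $\mathcal{P}$ of $V$ such that every member is either a dominating set of cardinality 1, or is not dominating and forms a coalition with some other member. The coalition graph ${\rm CG}(G,\mathcal{P})$ has vertex set $\mathcal{P}$, two members adjacent iff they form a coalition. $\Gamma_1$ is the partition of $V$ into singletons; $G$ is a singleton-partition graph (SP-graph) if $\Gamma_1$ is a coalition partition of $G$. A singleton coalition graph chain with initial graph $G_1$ is a sequence $G_1\to G_2\to\cdots$ where each graph having a successor is an SP-graph and its successor is ${\rm CG}(G_i,\Gamma_1)$ (up to isomorphism). The $G$-SC chain is such a chain starting at $G$ of maximum possible length (it continues as long as the current graph is an SP-graph; it is infinite if this never fails). Its length $L_{\rm SCC}(G)$ is $k-1$ for a chain $G_1\to\cdots\to G_k$ and $\infty$ for an infinite chain, with the convention that if all graphs in the chain are isomorphic the length is $0$. -}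

module Defs where

open import Data.Nat using (ℕ; zero; suc; _≤_; _<_)
open import Data.Bool using (Bool; true; false)
open import Data.Fin using (Fin; _≟_)
open import Data.Fin.Properties using (all?; any?)
open import Data.Fin.Subset using (Subset; _∈_; ⁅_⁆; _∪_; ∣_∣)
open import Data.Fin.Subset.Properties using (_∈?_)
open import Data.Vec using (tabulate)
open import Data.Product using (Σ; ∃; ∃-syntax; _×_; _,_)
open import Data.Sum using (_⊎_)
open import Relation.Nullary using (¬_; Dec; yes; no)
open import Relation.Nullary.Decidable using (⌊_⌋; _×-dec_; _⊎-dec_; ¬?)
open import Relation.Binary.PropositionalEquality using (_≡_; _≢_)
open import Function.Bundles using (_⤖_; Bijection)

Graph : ℕ → Set
Graph n = Fin n → Fin n → Bool

module _ {n : ℕ} where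

  E : Graph n → Fin n → Fin n → Set
  E G u v = G u v ≡ true

  IsSimple : Graph n → Set
  IsSimple G = (∀ u v → G u v ≡ G v u) × (∀ v → G v v ≡ false)

  deg : Graph n → Fin n → ℕ
  deg G v = ∣ tabulate (G v) ∣

  MinDegreeIs : Graph n → ℕ → Set
  MinDegreeIs G d = (∀ v → d ≤ deg G v) × (∃[ v ] deg G v ≡ d)

  IsFull : Graph n → Fin n → Set
  IsFull G v = ∀ u → u ≢ v → E G v u

  HasFullVertex : Graph n → Set
  HasFullVertex G = ∃[ v ] IsFull G v

  Dominating : Graph n → Subset n → Set
  Dominating G D = ∀ v → v ∈ D ⊎ (∃[ u ] (u ∈ D × E G u v))

  Disjoint : Subset n → Subset n → Set
  Disjoint A B = ∀ x → ¬ (x ∈ A × x ∈ B)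

  Coalition : Graph n → Subset n → Subset n → Set
  Coalition G A B =
    Disjoint A B × ¬ Dominating G A × ¬ Dominating G B × Dominating G (A ∪ B)

  E? : (G : Graph n) → ∀ u v → Dec (E G u v)
  E? G u v = Data.Bool._≟_ (G u v) true
    where import Data.Bool

  Dominating? : (G : Graph n) → (D : Subset n) → Dec (Dominating G D)
  Dominating? G D = all? (λ v → (v ∈? D) ⊎-dec any? (λ u → (u ∈? D) ×-dec E? G u v))

  Disjoint? : (A B : Subset n) → Dec (Disjoint A B)
  Disjoint? A B = all? (λ x → ¬? ((x ∈? A) ×-dec (x ∈? B)))

  Coalition? : (G : Graph n) → (A B : Subset n) → Dec (Coalition G A B)
  Coalition? G A B =
    Disjoint? A B ×-dec ¬? (Dominating? G A) ×-dec ¬? (Dominating? G B)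
      ×-dec Dominating? G (A ∪ B)

  -- G is a singleton-partition graph: the partition Γ₁ into singletons is a
  -- coalition partition (each singleton is a dominating set of cardinality 1,
  -- or is non-dominating and forms a coalition with another singleton).
  IsSP : Graph n → Set
  IsSP G = ∀ v → Dominating G ⁅ v ⁆
                 ⊎ (¬ Dominating G ⁅ v ⁆ × ∃[ u ] (u ≢ v × Coalition G ⁅ v ⁆ ⁅ u ⁆))

  -- The coalition graph CG(G, Γ₁), with the singleton {v} identified with v.
  CG : Graph n → Graph n
  CG G u v = ⌊ Coalition? G ⁅ u ⁆ ⁅ v ⁆ ⌋

  -- i-th iterate: iter 0 G = G = G₁, iter i G = G_{i+1}
  iter : ℕ → Graph n → Graph n
  iter zero G = G
  iter (suc i) G = CG (iter i G)

  Iso : Graph n → Graph n → Set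
  Iso G H = Σ (Fin n ⤖ Fin n) λ f →
    ∀ u v → G u v ≡ H (Bijection.to f u) (Bijection.to f v)

  -- G_{i+1} exists in the G-SC chain iff G₁,…,G_i are SP-graphs
  InChain : Graph n → ℕ → Set
  InChain G i = ∀ j → j < i → IsSP (iter j G)

  -- all graphs in the G-SC chain are isomorphic (then L_SCC(G) = 0 by convention)
  AllIsomorphic : Graph n → Set
  AllIsomorphic G = ∀ i → InChain G i → Iso G (iter i G)

  ChainInfinite : Graph n → Set
  ChainInfinite G = ∀ i → IsSP (iter i G)

  LSCC≡∞ : Graph n → Set
  LSCC≡∞ G = ChainInfinite G × ¬ AllIsomorphic G

  -- L_SCC(G) ≤ k : either the convention gives length 0, or the chain
  -- G₁ → … → G_m stops with m - 1 ≤ k, i.e. some G_{i+1} with i ≤ k is not SP.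
  LSCC≤ : Graph n → ℕ → Set
  LSCC≤ G k = AllIsomorphic G ⊎ (∃[ i ] (i ≤ k × ¬ IsSP (iter i G)))

-- Let w be a vertex of degree 2 with neighbours a and b, and call the other vertices outer.
-- A coalition of two singletons dominates w, so it meets {w, a, b}; hence the outer vertices
-- are independent in G₂ = CG G. A dominating vertex f of some Gᵢ is isolated in Gᵢ₊₁, so every
-- edge of Gᵢ₊₂ contains f; if Gᵢ₊₂ were SP, every other vertex would be allied with f there,
-- making f dominate Gᵢ₊₂, which an allied vertex cannot. With at least three outer vertices,
-- either G₃ is not SP, or G₃ has a dominating vertex, or G₂ is the complete bipartite graph
-- between {w, a, b} and the outer vertices; that graph is its own coalition graph and has
-- minimum degree 3, so the chain is infinite but not constant. With one or two outer vertices
-- G has order 4 or 5, and the finitely many cases are decided by computation.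

module Submission where

open import Defs
open import Data.Bool using (Bool; true; false)
open import Data.Bool.Properties using (¬-not)
import Data.Bool as Bool
open import Data.Empty using (⊥; ⊥-elim)
open import Data.Fin using (Fin; _≟_) renaming (zero to fz; suc to fs)
open import Data.Fin.Patterns using (0F; 1F; 2F; 3F; 4F)
open import Data.Fin.Properties using (all?; any?; suc-injective; ¬∀⟶∃¬)
open import Data.Fin.Subset using (Subset; _∈_; ⁅_⁆; _∪_; _-_; ∣_∣; inside; outside)
open import Data.Fin.Subset.Properties
  using (x∈⁅x⁆; x∈⁅y⁆⇒x≡y; x∈p∪q⁻; p⊆p∪q; q⊆p∪q; x∈p⇒∣p-x∣<∣p∣; x∈p∧x≢y⇒x∈p-y)
open import Data.Nat using (ℕ; zero; suc; _+_; _≤_; z≤n; s≤s)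
open import Data.Nat.Properties using (m≤m+n; ≤-reflexive; module ≤-Reasoning)
open import Data.Product using (∃-syntax; _×_; _,_; proj₂)
open import Data.Sum using (_⊎_; inj₁; inj₂; [_,_]′)
open import Data.Vec using (Vec; []; _∷_; tabulate)
open import Data.Vec.Base using () renaming (here to here[]; there to there[])
open import Data.Vec.Properties using (lookup∘tabulate; []=⇒lookup; lookup⇒[]=)
open import Data.Vec.Membership.Propositional using () renaming (_∈_ to _∈ᵥ_)
import Data.Vec.Membership.DecPropositional as DecMembership
open import Data.Vec.Relation.Unary.All using ([]; _∷_)
open import Data.Vec.Relation.Unary.AllPairs using (allPairs?; []; _∷_)
open import Data.Vec.Relation.Unary.Any using (here; there; index)
open import Data.Vec.Relation.Unary.Any.Properties using (lookup-index)
open import Data.Vec.Relation.Unary.Unique.Propositional using (Unique)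
open import Data.Vec.Relation.Unary.Unique.Propositional.Properties using (lookup-injective)
open import Function.Base using (_∘_; id)
open import Function.Bundles using (_⤖_; Bijection; mk⤖)
open import Function.Construct.Composition using (_⤖-∘_)
open import Function.Construct.Identity using (⤖-id)
open import Function.Construct.Symmetry using (⤖-sym)
open import Relation.Binary.PropositionalEquality using (_≡_; _≢_; refl; sym; trans; cong; cong₂; subst)
open import Relation.Nullary using (¬_; Dec; yes; no; contradiction)
open import Relation.Nullary.Decidable using (_×-dec_; _⊎-dec_; ¬?; map′; toWitness)

-- Domination and coalitions of single vertices

module _ {n : ℕ} where

  Covers : Graph n → Fin n → Fin n → Set
  Covers G v z = z ≡ v ⊎ E G v z

  Dominates : Graph n → Fin n → Set
  Dominates G v = ∀ z → Covers G v z

  PairCovers : Graph n → Fin n → Fin n → Fin n → Set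
  PairCovers G u v z = z ≡ u ⊎ z ≡ v ⊎ E G u z ⊎ E G v z

  PairDominates : Graph n → Fin n → Fin n → Set
  PairDominates G u v = ∀ z → PairCovers G u v z

  record Allied (G : Graph n) (u v : Fin n) : Set where
    constructor allied
    field
      distinct       : u ≢ v
      ¬dominatesˡ    : ¬ Dominates G u
      ¬dominatesʳ    : ¬ Dominates G v
      pair-dominates : PairDominates G u v

    covers : ∀ {z} → z ≢ u → z ≢ v → E G u z ⊎ E G v z
    covers {z} z≢u z≢v with pair-dominates z
    ... | inj₁ z≡u               = ⊥-elim (z≢u z≡u)
    ... | inj₂ (inj₁ z≡v)        = ⊥-elim (z≢v z≡v)
    ... | inj₂ (inj₂ adjacent)   = adjacent

  open Allied public

  IsSP′ : Graph n → Set
  IsSP′ G = ∀ v → Dominates G v ⊎ ∃[ u ] Allied G v u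

  private
    ∈⁅⁆⇒≡ : ∀ {x v : Fin n} → x ∈ ⁅ v ⁆ → x ≡ v
    ∈⁅⁆⇒≡ = x∈⁅y⁆⇒x≡y _

  Allied-sym : ∀ {G u v} → Allied G u v → Allied G v u
  Allied-sym al = record
    { distinct       = distinct al ∘ sym
    ; ¬dominatesˡ    = ¬dominatesʳ al
    ; ¬dominatesʳ    = ¬dominatesˡ al
    ; pair-dominates = λ z → swap (pair-dominates al z)
    }
    where
    swap : ∀ {P Q R S : Set} → P ⊎ Q ⊎ R ⊎ S → Q ⊎ P ⊎ S ⊎ R
    swap (inj₁ p)               = inj₂ (inj₁ p)
    swap (inj₂ (inj₁ q))        = inj₁ q
    swap (inj₂ (inj₂ (inj₁ r))) = inj₂ (inj₂ (inj₂ r))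
    swap (inj₂ (inj₂ (inj₂ s))) = inj₂ (inj₂ (inj₁ s))

  -- Lemmas are stated for any G′ with the edges of CG G: goals mentioning CG itself are very slow
  -- to normalise.
  record IsCoalitionGraph (G G′ : Graph n) : Set where
    field
      edge⇒allied : ∀ {u v} → E G′ u v → Allied G u v
      allied⇒edge : ∀ {u v} → Allied G u v → E G′ u v

    edge-sym : ∀ {u v} → E G′ u v → E G′ v u
    edge-sym = allied⇒edge ∘ Allied-sym ∘ edge⇒allied

    edge-irrefl : ∀ {v} → ¬ E G′ v v
    edge-irrefl e = distinct (edge⇒allied e) refl

  module _ (G : Graph n) where

    Dominating⁅⁆⇒Dominates : ∀ {v} → Dominating G ⁅ v ⁆ → Dominates G v
    Dominating⁅⁆⇒Dominates dom z with dom z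
    ... | inj₁ z∈         = inj₁ (∈⁅⁆⇒≡ z∈)
    ... | inj₂ (_ , u∈ , e) rewrite ∈⁅⁆⇒≡ u∈ = inj₂ e

    Dominates⇒Dominating⁅⁆ : ∀ {v} → Dominates G v → Dominating G ⁅ v ⁆
    Dominates⇒Dominating⁅⁆ {v} dom z with dom z
    ... | inj₁ refl = inj₁ (x∈⁅x⁆ z)
    ... | inj₂ e    = inj₂ (v , x∈⁅x⁆ v , e)

    Dominating⁅⁆∪⁅⁆⇒PairDominates : ∀ {u v} → Dominating G (⁅ u ⁆ ∪ ⁅ v ⁆) → PairDominates G u v
    Dominating⁅⁆∪⁅⁆⇒PairDominates {u} {v} dom z with dom z
    ... | inj₁ z∈ = [ inj₁ ∘ ∈⁅⁆⇒≡ , inj₂ ∘ inj₁ ∘ ∈⁅⁆⇒≡ ]′ (x∈p∪q⁻ ⁅ u ⁆ ⁅ v ⁆ z∈)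
    ... | inj₂ (t , t∈ , e) with x∈p∪q⁻ ⁅ u ⁆ ⁅ v ⁆ t∈
    ...   | inj₁ t∈⁅u⁆ rewrite ∈⁅⁆⇒≡ t∈⁅u⁆ = inj₂ (inj₂ (inj₁ e))
    ...   | inj₂ t∈⁅v⁆ rewrite ∈⁅⁆⇒≡ t∈⁅v⁆ = inj₂ (inj₂ (inj₂ e))

    PairDominates⇒Dominating⁅⁆∪⁅⁆ : ∀ {u v} → PairDominates G u v → Dominating G (⁅ u ⁆ ∪ ⁅ v ⁆)
    PairDominates⇒Dominating⁅⁆∪⁅⁆ {u} {v} dom z with dom z
    ... | inj₁ refl            = inj₁ (p⊆p∪q ⁅ v ⁆ (x∈⁅x⁆ z))
    ... | inj₂ (inj₁ refl)     = inj₁ (q⊆p∪q ⁅ u ⁆ ⁅ v ⁆ (x∈⁅x⁆ z))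
    ... | inj₂ (inj₂ (inj₁ e)) = inj₂ (u , p⊆p∪q ⁅ v ⁆ (x∈⁅x⁆ u) , e)
    ... | inj₂ (inj₂ (inj₂ e)) = inj₂ (v , q⊆p∪q ⁅ u ⁆ ⁅ v ⁆ (x∈⁅x⁆ v) , e)

    Coalition⁅⁆⇒Allied : ∀ {u v} → Coalition G ⁅ u ⁆ ⁅ v ⁆ → Allied G u v
    Coalition⁅⁆⇒Allied {u} (disjoint , ¬dom-u , ¬dom-v , dom) = record
      { distinct       = λ { refl → disjoint u (x∈⁅x⁆ u , x∈⁅x⁆ u) }
      ; ¬dominatesˡ    = ¬dom-u ∘ Dominates⇒Dominating⁅⁆
      ; ¬dominatesʳ    = ¬dom-v ∘ Dominates⇒Dominating⁅⁆
      ; pair-dominates = Dominating⁅⁆∪⁅⁆⇒PairDominates dom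
      }

    Allied⇒Coalition⁅⁆ : ∀ {u v} → Allied G u v → Coalition G ⁅ u ⁆ ⁅ v ⁆
    Allied⇒Coalition⁅⁆ al =
      (λ x (x∈u , x∈v) → distinct al (trans (sym (∈⁅⁆⇒≡ x∈u)) (∈⁅⁆⇒≡ x∈v))) ,
      ¬dominatesˡ al ∘ Dominating⁅⁆⇒Dominates ,
      ¬dominatesʳ al ∘ Dominating⁅⁆⇒Dominates ,
      PairDominates⇒Dominating⁅⁆∪⁅⁆ (pair-dominates al)

    CG-edge⇒Allied : ∀ {u v} → E (CG G) u v → Allied G u v
    CG-edge⇒Allied {u} {v} e with Coalition? G ⁅ u ⁆ ⁅ v ⁆
    ... | yes coalition = Coalition⁅⁆⇒Allied coalition

    Allied⇒CG-edge : ∀ {u v} → Allied G u v → E (CG G) u v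
    Allied⇒CG-edge {u} {v} al with Coalition? G ⁅ u ⁆ ⁅ v ⁆
    ... | yes _            = refl
    ... | no ¬coalition    = ⊥-elim (¬coalition (Allied⇒Coalition⁅⁆ al))

    IsSP⇒IsSP′ : IsSP G → IsSP′ G
    IsSP⇒IsSP′ sp v with sp v
    ... | inj₁ dom               = inj₁ (Dominating⁅⁆⇒Dominates dom)
    ... | inj₂ (_ , u , _ , coa) = inj₂ (u , Coalition⁅⁆⇒Allied coa)

    IsSP′⇒IsSP : IsSP′ G → IsSP G
    IsSP′⇒IsSP sp v with sp v
    ... | inj₁ dom      = inj₁ (Dominates⇒Dominating⁅⁆ dom)
    ... | inj₂ (u , al) =
      inj₂ (¬dominatesˡ al ∘ Dominating⁅⁆⇒Dominates , u , distinct al ∘ sym , Allied⇒Coalition⁅⁆ al)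

    Dominates? : ∀ v → Dec (Dominates G v)
    Dominates? v = all? λ z → z ≟ v ⊎-dec E? G v z

    PairDominates? : ∀ u v → Dec (PairDominates G u v)
    PairDominates? u v = all? λ z → z ≟ u ⊎-dec z ≟ v ⊎-dec E? G u z ⊎-dec E? G v z

    Allied? : ∀ u v → Dec (Allied G u v)
    Allied? u v =
      map′ (λ (d , ¬l , ¬r , p) → allied d ¬l ¬r p)
           (λ al → distinct al , ¬dominatesˡ al , ¬dominatesʳ al , pair-dominates al)
           (¬? (u ≟ v) ×-dec ¬? (Dominates? u) ×-dec ¬? (Dominates? v) ×-dec PairDominates? u v)

    IsSP′? : Dec (IsSP′ G)
    IsSP′? = all? λ v → Dominates? v ⊎-dec any? (Allied? v)

    IsSP? : Dec (IsSP G)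
    IsSP? = map′ IsSP′⇒IsSP IsSP⇒IsSP′ IsSP′?

    CG-isCoalitionGraph : IsCoalitionGraph G (CG G)
    CG-isCoalitionGraph = record { edge⇒allied = CG-edge⇒Allied ; allied⇒edge = Allied⇒CG-edge }

    Dominates⇒IsFull : ∀ {v} → Dominates G v → IsFull G v
    Dominates⇒IsFull dom u u≢v = [ ⊥-elim ∘ u≢v , id ]′ (dom u)

module _ {n : ℕ} where

  TwoNeighbours : Graph n → Fin n → Set
  TwoNeighbours G v = ∃[ p ] ∃[ q ] (p ≢ q × E G v p × E G v q)

  ThreeNeighbours : Graph n → Fin n → Set
  ThreeNeighbours G v = ∃[ p ] ∃[ q ] ∃[ r ] (p ≢ q × p ≢ r × q ≢ r × E G v p × E G v q × E G v r)

one-member : ∀ {n} (p : Subset n) → 1 ≤ ∣ p ∣ → ∃[ u ] u ∈ p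
one-member (inside ∷ p)  _ = fz , here[]
one-member (outside ∷ p) h with one-member p h
... | u , u∈ = fs u , there[] u∈

two-members : ∀ {n} (p : Subset n) → 2 ≤ ∣ p ∣ → ∃[ u ] ∃[ v ] (u ≢ v × u ∈ p × v ∈ p)
two-members (inside ∷ p) (s≤s h) with one-member p h
... | u , u∈ = fz , fs u , (λ ()) , here[] , there[] u∈
two-members (outside ∷ p) h with two-members p h
... | u , v , u≢v , u∈ , v∈ = fs u , fs v , u≢v ∘ suc-injective , there[] u∈ , there[] v∈

three-members⇒3≤∣p∣ : ∀ {n} {p : Subset n} {u v z} → u ≢ v → u ≢ z → v ≢ z → u ∈ p → v ∈ p → z ∈ p → 3 ≤ ∣ p ∣
three-members⇒3≤∣p∣ {p = p} {u} {v} {z} u≢v u≢z v≢z u∈ v∈ z∈ = begin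
  3                     ≤⟨ s≤s (s≤s (s≤s z≤n)) ⟩
  3 + ∣ p - u - v - z ∣ ≤⟨ s≤s (s≤s (x∈p⇒∣p-x∣<∣p∣ z∈p-u-v)) ⟩
  2 + ∣ p - u - v ∣     ≤⟨ s≤s (x∈p⇒∣p-x∣<∣p∣ v∈p-u) ⟩
  1 + ∣ p - u ∣         ≤⟨ x∈p⇒∣p-x∣<∣p∣ u∈ ⟩
  ∣ p ∣                 ∎
  where
  open ≤-Reasoning
  v∈p-u = x∈p∧x≢y⇒x∈p-y v∈ (u≢v ∘ sym)
  z∈p-u-v = x∈p∧x≢y⇒x∈p-y (x∈p∧x≢y⇒x∈p-y z∈ (u≢z ∘ sym)) (v≢z ∘ sym)

module _ {n : ℕ} (G : Graph n) where

  ∈-neighbourhood⇒E : ∀ {v u} → u ∈ tabulate (G v) → E G v u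
  ∈-neighbourhood⇒E {v} {u} u∈ = trans (sym (lookup∘tabulate (G v) u)) ([]=⇒lookup u∈)

  E⇒∈-neighbourhood : ∀ {v u} → E G v u → u ∈ tabulate (G v)
  E⇒∈-neighbourhood {v} {u} e = lookup⇒[]= u (tabulate (G v)) (trans (lookup∘tabulate (G v) u) e)

  two-neighbours : ∀ {v} → 2 ≤ deg G v → TwoNeighbours G v
  two-neighbours {v} 2≤deg with two-members (tabulate (G v)) 2≤deg
  ... | p , q , p≢q , p∈ , q∈ = p , q , p≢q , ∈-neighbourhood⇒E p∈ , ∈-neighbourhood⇒E q∈

  degree-two⇒neighbourhood : ∀ {v} → deg G v ≡ 2 →
    ∃[ a ] ∃[ b ] (a ≢ b × E G v a × E G v b × ∀ {z} → E G v z → z ≡ a ⊎ z ≡ b)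
  degree-two⇒neighbourhood {v} deg≡2 with two-neighbours (≤-reflexive (sym deg≡2))
  ... | a , b , a≢b , va , vb = a , b , a≢b , va , vb , only
    where
    only : ∀ {z} → E G v z → z ≡ a ⊎ z ≡ b
    only {z} vz with z ≟ a | z ≟ b
    ... | yes z≡a | _       = inj₁ z≡a
    ... | no _    | yes z≡b = inj₂ z≡b
    ... | no z≢a  | no z≢b  = contradiction (subst (3 ≤_) deg≡2
            (three-members⇒3≤∣p∣ a≢b (z≢a ∘ sym) (z≢b ∘ sym)
              (E⇒∈-neighbourhood va) (E⇒∈-neighbourhood vb) (E⇒∈-neighbourhood vz)))
            λ { (s≤s (s≤s ())) }

  not-three-neighbours : ∀ {v a b} → (∀ {z} → E G v z → z ≡ a ⊎ z ≡ b) → ¬ ThreeNeighbours G v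
  not-three-neighbours {a = a} {b} only (p , q , r , p≢q , p≢r , q≢r , vp , vq , vr) =
    pigeonhole (only vp) (only vq) (only vr)
    where
    pigeonhole : p ≡ a ⊎ p ≡ b → q ≡ a ⊎ q ≡ b → r ≡ a ⊎ r ≡ b → ⊥
    pigeonhole (inj₁ refl) (inj₁ refl) _           = p≢q refl
    pigeonhole (inj₂ refl) (inj₂ refl) _           = p≢q refl
    pigeonhole (inj₁ refl) (inj₂ refl) (inj₁ refl) = p≢r refl
    pigeonhole (inj₁ refl) (inj₂ refl) (inj₂ refl) = q≢r refl
    pigeonhole (inj₂ refl) (inj₁ refl) (inj₁ refl) = q≢r refl
    pigeonhole (inj₂ refl) (inj₁ refl) (inj₂ refl) = p≢r refl

true⇔true⇒≡ : ∀ {b c : Bool} → (b ≡ true → c ≡ true) → (c ≡ true → b ≡ true) → b ≡ c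
true⇔true⇒≡ {true}  {true}  _ _ = refl
true⇔true⇒≡ {true}  {false} f _ = sym (f refl)
true⇔true⇒≡ {false} {true}  _ g = g refl
true⇔true⇒≡ {false} {false} _ _ = refl

record _≅_ {m n : ℕ} (G : Graph m) (H : Graph n) : Set where
  constructor mk≅
  field
    bijection : Fin m ⤖ Fin n
    preserves : ∀ u v → G u v ≡ H (Bijection.to bijection u) (Bijection.to bijection v)

≅⇒Iso : ∀ {n} {G H : Graph n} → G ≅ H → Iso G H
≅⇒Iso (mk≅ f preserves) = f , preserves

Iso⇒≅ : ∀ {n} {G H : Graph n} → Iso G H → G ≅ H
Iso⇒≅ (f , preserves) = mk≅ f preserves

module Transport {m n : ℕ} {G : Graph m} {H : Graph n} (G≅H : G ≅ H) where

  private
    open _≅_ G≅H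
    f = Bijection.to bijection
    f-injective = Bijection.injective bijection
    f-onto = Bijection.strictlySurjective bijection

  edge-to : ∀ {u v} → E G u v → E H (f u) (f v)
  edge-to {u} {v} e = trans (sym (preserves u v)) e

  edge-from : ∀ {u v} → E H (f u) (f v) → E G u v
  edge-from {u} {v} e = trans (preserves u v) e

  dominates-to : ∀ {u} → Dominates G u → Dominates H (f u)
  dominates-to dom z with f-onto z
  ... | t , refl with dom t
  ...   | inj₁ refl = inj₁ refl
  ...   | inj₂ e    = inj₂ (edge-to e)

  dominates-from : ∀ {u} → Dominates H (f u) → Dominates G u
  dominates-from dom z with dom (f z)
  ... | inj₁ fz≡fu = inj₁ (f-injective fz≡fu)
  ... | inj₂ e     = inj₂ (edge-from e)

  pair-dominates-to : ∀ {u v} → PairDominates G u v → PairDominates H (f u) (f v)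
  pair-dominates-to dom z with f-onto z
  ... | t , refl with dom t
  ...   | inj₁ refl            = inj₁ refl
  ...   | inj₂ (inj₁ refl)     = inj₂ (inj₁ refl)
  ...   | inj₂ (inj₂ (inj₁ e)) = inj₂ (inj₂ (inj₁ (edge-to e)))
  ...   | inj₂ (inj₂ (inj₂ e)) = inj₂ (inj₂ (inj₂ (edge-to e)))

  pair-dominates-from : ∀ {u v} → PairDominates H (f u) (f v) → PairDominates G u v
  pair-dominates-from dom z with dom (f z)
  ... | inj₁ eq              = inj₁ (f-injective eq)
  ... | inj₂ (inj₁ eq)       = inj₂ (inj₁ (f-injective eq))
  ... | inj₂ (inj₂ (inj₁ e)) = inj₂ (inj₂ (inj₁ (edge-from e)))
  ... | inj₂ (inj₂ (inj₂ e)) = inj₂ (inj₂ (inj₂ (edge-from e)))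

  allied-to : ∀ {u v} → Allied G u v → Allied H (f u) (f v)
  allied-to al = record
    { distinct       = distinct al ∘ f-injective
    ; ¬dominatesˡ    = ¬dominatesˡ al ∘ dominates-from
    ; ¬dominatesʳ    = ¬dominatesʳ al ∘ dominates-from
    ; pair-dominates = pair-dominates-to (pair-dominates al)
    }

  allied-from : ∀ {u v} → Allied H (f u) (f v) → Allied G u v
  allied-from al = record
    { distinct       = distinct al ∘ cong f
    ; ¬dominatesˡ    = ¬dominatesˡ al ∘ dominates-to
    ; ¬dominatesʳ    = ¬dominatesʳ al ∘ dominates-to
    ; pair-dominates = pair-dominates-from (pair-dominates al)
    }

  CG-preserves : ∀ u v → CG G u v ≡ CG H (f u) (f v)
  CG-preserves u v = true⇔true⇒≡ (Allied⇒CG-edge H ∘ allied-to ∘ CG-edge⇒Allied G)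
                                 (Allied⇒CG-edge G ∘ allied-from ∘ CG-edge⇒Allied H)

  IsSP-to : IsSP G → IsSP H
  IsSP-to sp = IsSP′⇒IsSP H sp′
    where
    sp′ : IsSP′ H
    sp′ z with f-onto z
    ... | t , refl with IsSP⇒IsSP′ G sp t
    ...   | inj₁ dom      = inj₁ (dominates-to dom)
    ...   | inj₂ (u , al) = inj₂ (f u , allied-to al)

  two-neighbours-from : ∀ {v} → TwoNeighbours H (f v) → TwoNeighbours G v
  two-neighbours-from (p , q , p≢q , vp , vq) with f-onto p | f-onto q
  ... | p′ , refl | q′ , refl = p′ , q′ , p≢q ∘ cong f , edge-from vp , edge-from vq

  three-neighbours-from : ∀ {v} → ThreeNeighbours H (f v) → ThreeNeighbours G v
  three-neighbours-from (p , q , r , p≢q , p≢r , q≢r , vp , vq , vr) with f-onto p | f-onto q | f-onto r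
  ... | p′ , refl | q′ , refl | r′ , refl =
    p′ , q′ , r′ , p≢q ∘ cong f , p≢r ∘ cong f , q≢r ∘ cong f , edge-from vp , edge-from vq , edge-from vr

module _ {m n : ℕ} where

  ≅-CG : {G : Graph m} {H : Graph n} → G ≅ H → CG G ≅ CG H
  ≅-CG G≅H = mk≅ (_≅_.bijection G≅H) (Transport.CG-preserves G≅H)

  ≅-iter : {G : Graph m} {H : Graph n} → G ≅ H → ∀ i → iter i G ≅ iter i H
  ≅-iter G≅H zero    = G≅H
  ≅-iter G≅H (suc i) = ≅-CG (≅-iter G≅H i)

  ≅-sym : {G : Graph m} {H : Graph n} → G ≅ H → H ≅ G
  ≅-sym {G} {H} (mk≅ f preserves) = mk≅ (⤖-sym f) λ u v → sym (preserves′ u v)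
    where
    f⁻ = Bijection.to (⤖-sym f)
    preserves′ : ∀ u v → G (f⁻ u) (f⁻ v) ≡ H u v
    preserves′ u v = trans (preserves (f⁻ u) (f⁻ v)) (cong₂ H (inverse u) (inverse v))
      where
      inverse : ∀ z → Bijection.to f (f⁻ z) ≡ z
      inverse z = proj₂ (Bijection.strictlySurjective f z)

≅-refl : ∀ {n} {G : Graph n} → G ≅ G
≅-refl = mk≅ (⤖-id _) λ u v → refl

≅-trans : ∀ {l m n} {G : Graph l} {H : Graph m} {K : Graph n} → G ≅ H → H ≅ K → G ≅ K
≅-trans (mk≅ f p) (mk≅ g q) = mk≅ (g ⤖-∘ f) λ u v → trans (p u v) (q _ _)

≗⇒≅ : ∀ {n} {G H : Graph n} → (∀ u v → G u v ≡ H u v) → G ≅ H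
≗⇒≅ G≗H = mk≅ (⤖-id _) G≗H

-- A dominating vertex stops the chain two steps later

module DominatingVertex {n : ℕ} {H H₁ H₂ : Graph n}
  (H₁-coalition : IsCoalitionGraph H H₁) (H₂-coalition : IsCoalitionGraph H₁ H₂)
  {f : Fin n} (f-dominates : Dominates H f) where

  open IsCoalitionGraph

  isolated₁ : ∀ {z} → ¬ E H₁ z f
  isolated₁ e = ¬dominatesʳ (edge⇒allied H₁-coalition e) f-dominates

  edges₂-meet : ∀ {u v} → u ≢ f → v ≢ f → ¬ E H₂ u v
  edges₂-meet u≢f v≢f e with pair-dominates (edge⇒allied H₂-coalition e) f
  ... | inj₁ f≡u              = u≢f (sym f≡u)
  ... | inj₂ (inj₁ f≡v)       = v≢f (sym f≡v)
  ... | inj₂ (inj₂ (inj₁ uf)) = isolated₁ uf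
  ... | inj₂ (inj₂ (inj₂ vf)) = isolated₁ vf

  not-dominating₂ : ∀ {v t} → v ≢ f → t ≢ f → t ≢ v → ¬ Dominates H₂ v
  not-dominating₂ v≢f t≢f t≢v dom = [ t≢v , edges₂-meet v≢f t≢f ]′ (dom _)

  allies₂-miss : ∀ {v u t} → v ≢ f → u ≢ f → t ≢ f → t ≢ v → t ≢ u → ¬ Allied H₂ v u
  allies₂-miss v≢f u≢f t≢f t≢v t≢u al =
    [ edges₂-meet v≢f t≢f , edges₂-meet u≢f t≢f ]′ (covers al t≢v t≢u)

  ally₂-is-dominating : ∀ {v u t₁ t₂} → v ≢ f → t₁ ≢ f → t₂ ≢ f → t₁ ≢ v → t₂ ≢ v → t₁ ≢ t₂ →
                        Allied H₂ v u → u ≡ f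
  ally₂-is-dominating {u = u} {t₁} v≢f t₁≢f t₂≢f t₁≢v t₂≢v t₁≢t₂ al with u ≟ f | t₁ ≟ u
  ... | yes u≡f | _        = u≡f
  ... | no u≢f  | no t₁≢u  = ⊥-elim (allies₂-miss v≢f u≢f t₁≢f t₁≢v t₁≢u al)
  ... | no u≢f  | yes refl = ⊥-elim (allies₂-miss v≢f u≢f t₂≢f t₂≢v (t₁≢t₂ ∘ sym) al)

  adjacent₂-to-ally : ∀ {v z} → Allied H₂ v f → z ≢ v → z ≢ f → E H₂ f z
  adjacent₂-to-ally al z≢v z≢f = [ ⊥-elim ∘ edges₂-meet (distinct al) z≢f , id ]′ (covers al z≢v z≢f)

  -- Every other vertex must be allied with f in H₂, which makes f dominating there.
  not-SP₂ : ∀ {v₁ v₂ v₃} → v₁ ≢ f → v₂ ≢ f → v₃ ≢ f → v₁ ≢ v₂ → v₁ ≢ v₃ → v₂ ≢ v₃ → ¬ IsSP H₂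
  not-SP₂ {v₁} v₁≢f v₂≢f v₃≢f v₁≢v₂ v₁≢v₃ v₂≢v₃ sp = ¬dominatesʳ ally₁ f-dominates₂
    where
    allied-with-f : ∀ {v t₁ t₂} → v ≢ f → t₁ ≢ f → t₂ ≢ f → t₁ ≢ v → t₂ ≢ v → t₁ ≢ t₂ → Allied H₂ v f
    allied-with-f v≢f t₁≢f t₂≢f t₁≢v t₂≢v t₁≢t₂ with IsSP⇒IsSP′ H₂ sp _
    ... | inj₁ dom      = ⊥-elim (not-dominating₂ v≢f t₁≢f t₁≢v dom)
    ... | inj₂ (u , al) with ally₂-is-dominating v≢f t₁≢f t₂≢f t₁≢v t₂≢v t₁≢t₂ al
    ...   | refl = al

    ally₁ = allied-with-f v₁≢f v₂≢f v₃≢f (v₁≢v₂ ∘ sym) (v₁≢v₃ ∘ sym) v₂≢v₃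
    ally₂ = allied-with-f v₂≢f v₁≢f v₃≢f v₁≢v₂ (v₂≢v₃ ∘ sym) v₁≢v₃

    f-dominates₂ : Dominates H₂ f
    f-dominates₂ z with z ≟ f | z ≟ v₁
    ... | yes z≡f | _        = inj₁ z≡f
    ... | no z≢f  | yes refl = inj₂ (adjacent₂-to-ally ally₂ v₁≢v₂ z≢f)
    ... | no z≢f  | no z≢v₁  = inj₂ (adjacent₂-to-ally ally₁ z≢v₁ z≢f)

  not-SP₂-of-four : ∀ {p q r s} → p ≢ q → p ≢ r → p ≢ s → q ≢ r → q ≢ s → r ≢ s → ¬ IsSP H₂
  not-SP₂-of-four {p} {q} {r} p≢q p≢r p≢s q≢r q≢s r≢s with p ≟ f | q ≟ f | r ≟ f
  ... | yes refl | _        | _        = not-SP₂ (p≢q ∘ sym) (p≢r ∘ sym) (p≢s ∘ sym) q≢r q≢s r≢s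
  ... | no p≢f   | yes refl | _        = not-SP₂ p≢f (q≢r ∘ sym) (q≢s ∘ sym) p≢r p≢s r≢s
  ... | no p≢f   | no q≢f   | yes refl = not-SP₂ p≢f q≢f (r≢s ∘ sym) p≢q p≢s q≢s
  ... | no p≢f   | no q≢f   | no r≢f   = not-SP₂ p≢f q≢f r≢f p≢q p≢r q≢r

-- The complete bipartite fixed point

module _ {n : ℕ} where

  OneOf : Fin n → Fin n → Fin n → Fin n → Set
  OneOf p q r z = z ≡ p ⊎ z ≡ q ⊎ z ≡ r

  OneOf? : ∀ p q r z → Dec (OneOf p q r z)
  OneOf? p q r z = z ≟ p ⊎-dec z ≟ q ⊎-dec z ≟ r

-- K is forced to be the complete bipartite graph between {w, a, b} and the remaining vertices,
-- which is its own coalition graph.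
module CompleteBipartiteCore {n : ℕ} {K K′ : Graph n} (K′-coalition : IsCoalitionGraph K K′)
  (K-sym : ∀ {u v} → E K u v → E K v u) (K-irrefl : ∀ {v} → ¬ E K v v)
  {w a b : Fin n} (w≢a : w ≢ a) (w≢b : w ≢ b) (a≢b : a ≢ b)
  {o₁ o₂ o₃ : Fin n} (o₁≢o₂ : o₁ ≢ o₂) (o₁≢o₃ : o₁ ≢ o₃) (o₂≢o₃ : o₂ ≢ o₃)
  (o₁-outer : ¬ OneOf w a b o₁) (o₂-outer : ¬ OneOf w a b o₂) (o₃-outer : ¬ OneOf w a b o₃)
  (outer-independent : ∀ {x y} → ¬ OneOf w a b x → ¬ OneOf w a b y → ¬ E K x y)
  (no-dominating′ : ∀ v → ¬ Dominates K′ v)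
  (outer-allied′ : ∀ {x} → ¬ OneOf w a b x → ∃[ c ] Allied K′ x c) where

  open IsCoalitionGraph K′-coalition

  Core : Fin n → Set
  Core = OneOf w a b

  Outer : Fin n → Set
  Outer z = ¬ Core z

  Complete : Fin n → Set
  Complete c = ∀ z → Outer z → E K c z

  record Triple (p q r : Fin n) : Set where
    field
      p≢q : p ≢ q
      p≢r : p ≢ r
      q≢r : q ≢ r
      p∈ : Core p
      q∈ : Core q
      r∈ : Core r
      cover : ∀ {z} → Core z → OneOf p q r z

    all : ∀ {P : Fin n → Set} → P p → P q → P r → ∀ {z} → Core z → P z
    all Pp Pq Pr z∈ with cover z∈
    ... | inj₁ refl        = Pp
    ... | inj₂ (inj₁ refl) = Pq
    ... | inj₂ (inj₂ refl) = Pr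

  open Triple

  triple-swap₁₂ : ∀ {p q r} → Triple p q r → Triple q p r
  triple-swap₁₂ {p} {q} {r} t = record
    { p≢q = p≢q t ∘ sym ; p≢r = q≢r t ; q≢r = p≢r t ; p∈ = q∈ t ; q∈ = p∈ t ; r∈ = r∈ t
    ; cover = all t {OneOf q p r} (inj₂ (inj₁ refl)) (inj₁ refl) (inj₂ (inj₂ refl)) }

  triple-swap₂₃ : ∀ {p q r} → Triple p q r → Triple p r q
  triple-swap₂₃ {p} {q} {r} t = record
    { p≢q = p≢r t ; p≢r = p≢q t ; q≢r = q≢r t ∘ sym ; p∈ = p∈ t ; q∈ = r∈ t ; r∈ = q∈ t
    ; cover = all t {OneOf p r q} (inj₁ refl) (inj₂ (inj₂ refl)) (inj₂ (inj₁ refl)) }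

  w-a-b : Triple w a b
  w-a-b = record
    { p≢q = w≢a ; p≢r = w≢b ; q≢r = a≢b
    ; p∈ = inj₁ refl ; q∈ = inj₂ (inj₁ refl) ; r∈ = inj₂ (inj₂ refl) ; cover = id }

  triple-from : ∀ {p} → Core p → ∃[ q ] ∃[ r ] Triple p q r
  triple-from (inj₁ refl)        = a , b , w-a-b
  triple-from (inj₂ (inj₁ refl)) = w , b , triple-swap₁₂ w-a-b
  triple-from (inj₂ (inj₂ refl)) = w , a , triple-swap₁₂ (triple-swap₂₃ w-a-b)

  triple-from₂ : ∀ {p q} → Core p → Core q → p ≢ q → ∃[ r ] Triple p q r
  triple-from₂ {q = q} p∈ q∈ p≢q with triple-from p∈
  ... | q′ , r′ , t with cover t q∈
  ...   | inj₁ q≡p         = ⊥-elim (p≢q (sym q≡p))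
  ...   | inj₂ (inj₁ refl) = r′ , t
  ...   | inj₂ (inj₂ refl) = q′ , triple-swap₂₃ t

  core≢outer : ∀ {c x} → Core c → Outer x → c ≢ x
  core≢outer c∈ x-outer refl = x-outer c∈

  outer-avoiding : ∀ x y → ∃[ t ] (Outer t × t ≢ x × t ≢ y)
  outer-avoiding x y with o₁ ≟ x | o₁ ≟ y | o₂ ≟ x | o₂ ≟ y
  ... | no o₁≢x | no o₁≢y | _       | _       = o₁ , o₁-outer , o₁≢x , o₁≢y
  ... | yes refl | _      | _       | no o₂≢y = o₂ , o₂-outer , o₁≢o₂ ∘ sym , o₂≢y
  ... | _       | yes refl | no o₂≢x | _      = o₂ , o₂-outer , o₂≢x , o₁≢o₂ ∘ sym
  ... | yes refl | _      | _       | yes refl = o₃ , o₃-outer , o₁≢o₃ ∘ sym , o₂≢o₃ ∘ sym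
  ... | _       | yes refl | yes refl | _      = o₃ , o₃-outer , o₂≢o₃ ∘ sym , o₁≢o₃ ∘ sym

  outer-not-dominating : ∀ {x} → Outer x → ¬ Dominates K x
  outer-not-dominating {x} x-outer dom with outer-avoiding x x
  ... | t , t-outer , t≢x , _ = [ t≢x , outer-independent x-outer t-outer ]′ (dom t)

  outer-independent′ : ∀ {x y} → Outer x → Outer y → ¬ E K′ x y
  outer-independent′ {x} {y} x-outer y-outer e with outer-avoiding x y
  ... | t , t-outer , t≢x , t≢y =
    [ outer-independent x-outer t-outer , outer-independent y-outer t-outer ]′
      (covers (edge⇒allied e) t≢x t≢y)

  ally-in-core : ∀ {x c} → Outer x → Allied K′ x c → Core c
  ally-in-core {x} {c} x-outer al with OneOf? w a b c
  ... | yes c∈ = c∈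
  ... | no c-outer with outer-avoiding x c
  ...   | t , t-outer , t≢x , t≢c =
    ⊥-elim ([ outer-independent′ x-outer t-outer , outer-independent′ c-outer t-outer ]′
              (covers al t≢x t≢c))

  ally-adjacent′ : ∀ {x c y} → Outer x → Allied K′ x c → Outer y → y ≢ x → E K′ c y
  ally-adjacent′ x-outer al y-outer y≢x =
    [ ⊥-elim ∘ outer-independent′ x-outer y-outer , id ]′
      (covers al y≢x (core≢outer (ally-in-core x-outer al) y-outer ∘ sym))

  adjacent′-complete-but : ∀ {c y} → Core c → Outer y → E K′ c y →
                           ∀ {z} → Outer z → z ≢ y → E K c z
  adjacent′-complete-but c∈ y-outer e z-outer z≢y =
    [ id , ⊥-elim ∘ outer-independent y-outer z-outer ]′
      (covers (edge⇒allied e) (core≢outer c∈ z-outer ∘ sym) z≢y)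

  ally-complete : ∀ {x c} → Outer x → Allied K′ x c → Complete c
  ally-complete {x} x-outer al z z-outer with outer-avoiding x z
  ... | t , t-outer , t≢x , t≢z =
    adjacent′-complete-but (ally-in-core x-outer al) t-outer (ally-adjacent′ x-outer al t-outer t≢x)
      z-outer (t≢z ∘ sym)

  endpoint-not-dominating : ∀ {u v} → E K′ u v → ¬ Dominates K u
  endpoint-not-dominating e = ¬dominatesˡ (edge⇒allied e)

  not-dominating : ∀ v → ¬ Dominates K v
  not-dominating v with OneOf? w a b v | outer-allied′ o₁-outer
  ... | no v-outer | _ = outer-not-dominating v-outer
  ... | yes v∈ | c , al with v ≟ c
  ...   | yes refl = endpoint-not-dominating (ally-adjacent′ o₁-outer al o₂-outer (o₁≢o₂ ∘ sym))
  ...   | no v≢c   =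
    [ endpoint-not-dominating ∘ edge-sym , endpoint-not-dominating ∘ edge-sym ]′
      (covers al (core≢outer v∈ o₁-outer) v≢c)

  pair-dominates⇒adjacent′ : ∀ {u v} → u ≢ v → PairDominates K u v → E K′ u v
  pair-dominates⇒adjacent′ u≢v dom = allied⇒edge (allied u≢v (not-dominating _) (not-dominating _) dom)

  pair-dominates-split : ∀ {u v} → (∀ {z} → Outer z → E K u z ⊎ E K v z) →
                         (∀ {z} → Core z → z ≡ u ⊎ z ≡ v ⊎ E K u z ⊎ E K v z) → PairDominates K u v
  pair-dominates-split outer core z with OneOf? w a b z
  ... | yes z∈     = core z∈
  ... | no z-outer = inj₂ (inj₂ (outer z-outer))

  complete-or-adjacent : ∀ {f g z} → Outer z → Complete g ⊎ E K f g → E K f g ⊎ E K z g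
  complete-or-adjacent z-outer (inj₁ g-complete) = inj₂ (K-sym (g-complete _ z-outer))
  complete-or-adjacent z-outer (inj₂ e)          = inj₁ e

  dominates′-configuration : ∀ {f g h} → Triple f g h → Complete f →
                             Complete g ⊎ E K f g → Complete h ⊎ E K f h →
                             E K f h ⊎ E K g h → E K f g ⊎ E K h g → Dominates K′ f
  dominates′-configuration {f} {g} {h} t f-complete g-ok h-ok h-covered g-covered z with OneOf? w a b z
  ... | yes z∈ = all t {Covers K′ f} (inj₁ refl) (inj₂ f-g) (inj₂ f-h) z∈
    where
    f-g = pair-dominates⇒adjacent′ (p≢q t) (pair-dominates-split (inj₁ ∘ f-complete _)
            (all t {PairCovers K f g} (inj₁ refl) (inj₂ (inj₁ refl)) (inj₂ (inj₂ h-covered))))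
    f-h = pair-dominates⇒adjacent′ (p≢r t) (pair-dominates-split (inj₁ ∘ f-complete _)
            (all t {PairCovers K f h} (inj₁ refl) (inj₂ (inj₂ g-covered)) (inj₂ (inj₁ refl))))
  ... | no z-outer = inj₂ (pair-dominates⇒adjacent′ (core≢outer (p∈ t) z-outer)
                      (pair-dominates-split (inj₁ ∘ f-complete _)
                        (all t {PairCovers K f z} (inj₁ refl) (inj₂ (inj₂ (complete-or-adjacent z-outer g-ok)))
                                           (inj₂ (inj₂ (complete-or-adjacent z-outer h-ok))))))

  complete-not-adjacent-to-both : ∀ {p q r} → Triple p q r → Complete p → E K p q → E K p r → ⊥
  complete-not-adjacent-to-both {p} t p-complete pq pr = not-dominating p dom
    where
    dom : Dominates K p
    dom z with OneOf? w a b z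
    ... | yes z∈     = all t {Covers K p} (inj₁ refl) (inj₂ pq) (inj₂ pr) z∈
    ... | no z-outer = inj₂ (p-complete z z-outer)

  non-neighbour-of-ally : ∀ {x c d} → Outer x → Allied K′ x c → Core d → d ≢ c → ¬ E K c d →
                          ∀ {y} → Outer y → y ≢ x → E K d y
  non-neighbour-of-ally x-outer al d∈ d≢c ¬cd y-outer y≢x =
    [ ⊥-elim ∘ ¬cd , K-sym ]′
      (covers (edge⇒allied (ally-adjacent′ x-outer al y-outer y≢x)) d≢c (core≢outer d∈ y-outer))

  complete-from-two : ∀ {d x₁ x₂} → (∀ {z} → Outer z → z ≢ x₁ → E K d z) →
                      (∀ {z} → Outer z → z ≢ x₂ → E K d z) → x₁ ≢ x₂ → Complete d
  complete-from-two {x₁ = x₁} h₁ h₂ x₁≢x₂ z z-outer with z ≟ x₁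
  ... | yes refl = h₂ z-outer x₁≢x₂
  ... | no z≢x₁  = h₁ z-outer z≢x₁

  complete-but-one : ∀ {d x} → (∀ {z} → Outer z → z ≢ x → E K d z) → E K d x → Complete d
  complete-but-one {x = x} h dx z z-outer with z ≟ x
  ... | yes refl = dx
  ... | no z≢x   = h z-outer z≢x

  module SharedAlly {c} (al₁ : Allied K′ o₁ c) (al₂ : Allied K′ o₂ c) where

    c∈ = ally-in-core o₁-outer al₁
    c-complete = ally-complete o₁-outer al₁

    non-neighbour-complete : ∀ {d} → Core d → d ≢ c → ¬ E K c d → Complete d
    non-neighbour-complete d∈ d≢c ¬cd =
      complete-from-two (non-neighbour-of-ally o₁-outer al₁ d∈ d≢c ¬cd)
                        (non-neighbour-of-ally o₂-outer al₂ d∈ d≢c ¬cd) o₁≢o₂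

    neighbour-complete : ∀ {q r} → Triple c q r → E K c q → ¬ E K c r → Complete q
    neighbour-complete {q} t cq ¬cr = complete-from-two (via o₁-outer al₁) (via o₂-outer al₂) o₁≢o₂
      where
      r-complete = non-neighbour-complete (r∈ t) (p≢r t ∘ sym) ¬cr
      via : ∀ {x} → Outer x → Allied K′ x c → ∀ {z} → Outer z → z ≢ x → E K q z
      via x-outer al with covers al (core≢outer (q∈ t) x-outer) (p≢q t ∘ sym)
      ... | inj₁ x′q = adjacent′-complete-but (q∈ t) x-outer (edge-sym x′q)
      ... | inj₂ c′q with covers (edge⇒allied c′q) (p≢r t ∘ sym) (q≢r t ∘ sym)
      ...   | inj₁ cr = ⊥-elim (¬cr cr)
      ...   | inj₂ qr = ⊥-elim (no-dominating′ c
              (dominates′-configuration t c-complete (inj₂ cq) (inj₁ r-complete) (inj₂ qr) (inj₁ cq)))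

    core-complete : ∀ {d} → Core d → Complete d
    core-complete with triple-from c∈
    ... | q , r , t with E? K c q | E? K c r
    ...   | yes cq | yes cr = ⊥-elim (complete-not-adjacent-to-both t c-complete cq cr)
    ...   | yes cq | no ¬cr = all t c-complete (neighbour-complete t cq ¬cr)
                                (non-neighbour-complete (r∈ t) (p≢r t ∘ sym) ¬cr)
    ...   | no ¬cq | yes cr = all t c-complete (non-neighbour-complete (q∈ t) (p≢q t ∘ sym) ¬cq)
                                (neighbour-complete (triple-swap₂₃ t) cr ¬cq)
    ...   | no ¬cq | no ¬cr = all t c-complete (non-neighbour-complete (q∈ t) (p≢q t ∘ sym) ¬cq)
                                (non-neighbour-complete (r∈ t) (p≢r t ∘ sym) ¬cr)

  ally-neighbour-misses-other-ally : ∀ {x₁ c₁ x₂ c₂ d} → Triple c₁ c₂ d → Outer x₁ → Outer x₂ →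
                                    Allied K′ x₁ c₁ → Allied K′ x₂ c₂ → E K c₁ d → ¬ E K d c₂
  ally-neighbour-misses-other-ally {c₁ = c₁} t x₁-outer x₂-outer al₁ al₂ c₁d dc₂ =
    no-dominating′ c₁ (dominates′-configuration (triple-swap₂₃ t) (ally-complete x₁-outer al₁) (inj₂ c₁d)
                           (inj₁ (ally-complete x₂-outer al₂)) (inj₂ dc₂) (inj₁ c₁d))

  neighbour-of-ally-complete : ∀ {x₁ c₁ x₂ c₂ d} → Triple c₁ c₂ d → Outer x₁ → Outer x₂ → x₁ ≢ x₂ →
                               Allied K′ x₁ c₁ → Allied K′ x₂ c₂ → E K c₁ d → Complete d
  neighbour-of-ally-complete {x₁} t x₁-outer x₂-outer x₁≢x₂ al₁ al₂ c₁d
    with ally-neighbour-misses-other-ally t x₁-outer x₂-outer al₁ al₂ c₁d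
       | covers al₁ (core≢outer (r∈ t) x₁-outer) (p≢r t ∘ sym)
  ... | ¬dc₂ | inj₂ c₁′d =
    ⊥-elim ([ (λ c₁c₂ → complete-not-adjacent-to-both t (ally-complete x₁-outer al₁) c₁c₂ c₁d) , ¬dc₂ ]′
              (covers (edge⇒allied c₁′d) (p≢q t ∘ sym) (q≢r t)))
  ... | ¬dc₂ | inj₁ x₁′d with E? K _ x₁
  ...   | yes dx₁ = complete-but-one (adjacent′-complete-but (r∈ t) x₁-outer (edge-sym x₁′d)) dx₁
  ...   | no ¬dx₁ = ⊥-elim (¬dx₁ (non-neighbour-of-ally x₂-outer al₂ (r∈ t) (q≢r t ∘ sym) (¬dc₂ ∘ K-sym)
                                     x₁-outer x₁≢x₂))

  core-complete : ∀ {d} → Core d → Complete d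
  core-complete with outer-allied′ o₁-outer | outer-allied′ o₂-outer
  ... | c₁ , al₁ | c₂ , al₂ with c₁ ≟ c₂
  ...   | yes refl = SharedAlly.core-complete al₁ al₂
  ...   | no c₁≢c₂ with triple-from₂ (ally-in-core o₁-outer al₁) (ally-in-core o₂-outer al₂) c₁≢c₂
  ...     | e , t = all t (ally-complete o₁-outer al₁) (ally-complete o₂-outer al₂) e-complete
    where
    e-complete : Complete e
    e-complete with E? K c₁ e | E? K c₂ e
    ... | yes c₁e | _       = neighbour-of-ally-complete t o₁-outer o₂-outer o₁≢o₂ al₁ al₂ c₁e
    ... | no _    | yes c₂e = neighbour-of-ally-complete (triple-swap₁₂ t) o₂-outer o₁-outer (o₁≢o₂ ∘ sym)
                                al₂ al₁ c₂e
    ... | no ¬c₁e | no ¬c₂e =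
      complete-from-two (non-neighbour-of-ally o₁-outer al₁ (r∈ t) (p≢r t ∘ sym) ¬c₁e)
                        (non-neighbour-of-ally o₂-outer al₂ (r∈ t) (q≢r t ∘ sym) ¬c₂e) o₁≢o₂

  core-independent : ∀ {c d} → Core c → Core d → ¬ E K c d
  core-independent {c} {d} c∈ d∈ cd with c ≟ d
  ... | yes refl = K-irrefl cd
  ... | no c≢d with triple-from₂ c∈ d∈ c≢d
  ...   | r , t = no-dominating′ r
          (dominates′-configuration (triple-swap₁₂ (triple-swap₂₃ t)) (core-complete (r∈ t))
             (inj₁ (core-complete c∈)) (inj₁ (core-complete d∈)) (inj₂ cd) (inj₂ (K-sym cd)))

  coalition-graph-fixed : ∀ u v → K′ u v ≡ K u v
  coalition-graph-fixed u v = true⇔true⇒≡ to from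
    where
    to : E K′ u v → E K u v
    to e with OneOf? w a b u | OneOf? w a b v
    ... | yes u∈     | yes v∈     with triple-from₂ u∈ v∈ (distinct (edge⇒allied e))
    ...   | r , t = ⊥-elim ([ core-independent u∈ (r∈ t) , core-independent v∈ (r∈ t) ]′
                              (covers (edge⇒allied e) (p≢r t ∘ sym) (q≢r t ∘ sym)))
    to e | yes u∈     | no v-outer = core-complete u∈ v v-outer
    to e | no u-outer | yes v∈     = K-sym (core-complete v∈ u u-outer)
    to e | no u-outer | no v-outer = ⊥-elim (outer-independent′ u-outer v-outer e)
    from : E K u v → E K′ u v
    from e with OneOf? w a b u | OneOf? w a b v
    ... | yes u∈     | yes v∈     = ⊥-elim (core-independent u∈ v∈ e)
    ... | yes u∈     | no v-outer =
      pair-dominates⇒adjacent′ (core≢outer u∈ v-outer)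
        (pair-dominates-split (inj₁ ∘ core-complete u∈ _)
                              (λ z∈ → inj₂ (inj₂ (inj₂ (K-sym (core-complete z∈ v v-outer))))))
    ... | no u-outer | yes v∈     =
      pair-dominates⇒adjacent′ (core≢outer v∈ u-outer ∘ sym)
        (pair-dominates-split (inj₂ ∘ core-complete v∈ _)
                              (λ z∈ → inj₂ (inj₂ (inj₁ (K-sym (core-complete z∈ u u-outer))))))
    ... | no u-outer | no v-outer = ⊥-elim (outer-independent u-outer v-outer e)

  every-vertex-three-neighbours : ∀ v → ThreeNeighbours K v
  every-vertex-three-neighbours v with OneOf? w a b v
  ... | yes v∈     = o₁ , o₂ , o₃ , o₁≢o₂ , o₁≢o₃ , o₂≢o₃ ,
                     core-complete v∈ o₁ o₁-outer , core-complete v∈ o₂ o₂-outer , core-complete v∈ o₃ o₃-outer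
  ... | no v-outer = w , a , b , w≢a , w≢b , a≢b ,
                     K-sym (core-complete (p∈ w-a-b) v v-outer) , K-sym (core-complete (q∈ w-a-b) v v-outer) ,
                     K-sym (core-complete (r∈ w-a-b) v v-outer)

module Chain {n : ℕ} (G : Graph n) where

  iter-isCoalitionGraph : ∀ i → IsCoalitionGraph (iter i G) (iter (suc i) G)
  iter-isCoalitionGraph i = CG-isCoalitionGraph (iter i G)

  chain-stops : ∀ i k → ¬ IsSP (iter i G) → LSCC≡∞ G ⊎ LSCC≤ G (i + k)
  chain-stops i k ¬sp = inj₂ (inj₂ (i , m≤m+n i k , ¬sp))

  dominating⇒not-SP : ∀ i {f p q r s} → Dominates (iter i G) f →
                      p ≢ q → p ≢ r → p ≢ s → q ≢ r → q ≢ s → r ≢ s → ¬ IsSP (iter (2 + i) G)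
  dominating⇒not-SP i dom =
    DominatingVertex.not-SP₂-of-four (iter-isCoalitionGraph i) (iter-isCoalitionGraph (suc i)) dom

  self-similar⇒all-isomorphic : G ≅ iter 1 G → AllIsomorphic G
  self-similar⇒all-isomorphic G≅G₁ i _ = ≅⇒Iso (isomorphic i)
    where
    step : ∀ i → iter i G ≅ iter (suc i) G
    step zero    = G≅G₁
    step (suc i) = ≅-CG (step i)
    isomorphic : ∀ i → G ≅ iter i G
    isomorphic zero    = ≅-refl
    isomorphic (suc i) = ≅-trans (isomorphic i) (step i)

  ¬self-similar⇒¬all-isomorphic : IsSP G → ¬ G ≅ iter 1 G → ¬ AllIsomorphic G
  ¬self-similar⇒¬all-isomorphic sp ¬G≅G₁ all-iso = ¬G≅G₁ (Iso⇒≅ (all-iso 1 λ { zero _ → sp ; (suc _) (s≤s ()) }))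

  stationary⇒infinite : IsSP G → IsSP (iter 1 G) → (∀ u v → iter 2 G u v ≡ iter 1 G u v) → ChainInfinite G
  stationary⇒infinite sp sp₁ fixed zero    = sp
  stationary⇒infinite sp sp₁ fixed (suc i) = Transport.IsSP-to (≅-sym (stationary i)) sp₁
    where
    stationary : ∀ i → iter (suc i) G ≅ iter 1 G
    stationary zero    = ≅-refl
    stationary (suc i) = ≅-trans (≅-CG (stationary i)) (≗⇒≅ fixed)

-- Graphs of order four and five

enumeration : ∀ {m n} (vs : Vec (Fin n) m) → Unique vs → (∀ z → z ∈ᵥ vs) → Fin m ⤖ Fin n
enumeration vs unique cover =
  mk⤖ (lookup-injective unique _ _ , λ z → index (cover z) , λ { refl → sym (lookup-index (cover z)) })

module _ {m : ℕ} where

  Hypotheses : Graph m → Set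
  Hypotheses T = (∀ v → ¬ Dominates T v) × (∀ v → TwoNeighbours T v) × IsSP T

  Outcome : Fin m ⤖ Fin m → Graph m → Set
  Outcome φ T = ¬ Hypotheses T ⊎ ¬ IsSP (iter 1 T) ⊎ (∃[ v ] Dominates (iter 1 T) v) ⊎
                (∃[ v ] Dominates (iter 2 T) v) ⊎ (∀ u v → T u v ≡ iter 1 T (Bijection.to φ u) (Bijection.to φ v))

  Outcome? : ∀ φ T → Dec (Outcome φ T)
  Outcome? φ T =
    ¬? (all? (¬? ∘ Dominates? T) ×-dec all? TwoNeighbours? ×-dec IsSP? T) ⊎-dec ¬? (IsSP? (iter 1 T)) ⊎-dec
    any? (Dominates? (iter 1 T)) ⊎-dec any? (Dominates? (iter 2 T)) ⊎-dec
    all? (λ u → all? λ v → T u v Bool.≟ iter 1 T (Bijection.to φ u) (Bijection.to φ v))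
    where
    TwoNeighbours? : ∀ v → Dec (TwoNeighbours T v)
    TwoNeighbours? v = any? λ p → any? λ q → ¬? (p ≟ q) ×-dec E? T v p ×-dec E? T v q

∀-Bool? : {P : Bool → Set} → (∀ b → Dec (P b)) → Dec (∀ b → P b)
∀-Bool? P? with P? false | P? true
... | yes P-false | yes P-true = yes λ { false → P-false ; true → P-true }
... | no ¬P-false | _          = no λ P → ¬P-false (P false)
... | _           | no ¬P-true = no λ P → ¬P-true (P true)

-- Vertices 0F, 1F, 2F, 3F stand for w, a, b, x; w is adjacent to exactly a and b.
graph₄ : (ab ax bx : Bool) → Graph 4
graph₄ ab ax bx = λ where
  0F 0F → false ; 0F 1F → true  ; 0F 2F → true  ; 0F 3F → false
  1F 0F → true  ; 1F 1F → false ; 1F 2F → ab    ; 1F 3F → ax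
  2F 0F → true  ; 2F 1F → ab    ; 2F 2F → false ; 2F 3F → bx
  3F 0F → false ; 3F 1F → ax    ; 3F 2F → bx    ; 3F 3F → false

-- Vertices 0F, …, 4F stand for w, a, b, x, y; w is adjacent to exactly a and b.
graph₅ : (ab ax ay bx by xy : Bool) → Graph 5
graph₅ ab ax ay bx by xy = λ where
  0F 0F → false ; 0F 1F → true  ; 0F 2F → true  ; 0F 3F → false ; 0F 4F → false
  1F 0F → true  ; 1F 1F → false ; 1F 2F → ab    ; 1F 3F → ax    ; 1F 4F → ay
  2F 0F → true  ; 2F 1F → ab    ; 2F 2F → false ; 2F 3F → bx    ; 2F 4F → by
  3F 0F → false ; 3F 1F → ax    ; 3F 2F → bx    ; 3F 3F → false ; 3F 4F → xy
  4F 0F → false ; 4F 1F → ay    ; 4F 2F → by    ; 4F 3F → xy    ; 4F 4F → false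

-- The 5-cycle w a x y b is isomorphic to its coalition graph, its complement, via this permutation.
relabelling₅ : Fin 5 ⤖ Fin 5
relabelling₅ = enumeration order (toWitness {a? = allPairs? (λ i j → ¬? (i ≟ j)) order} _)
                              (toWitness {a? = all? (_∈? order)} _)
  where
  open DecMembership (_≟_ {5}) using (_∈?_)
  order = 0F ∷ 3F ∷ 4F ∷ 2F ∷ 1F ∷ []

outcome₄ : ∀ ab ax bx → Outcome (⤖-id _) (graph₄ ab ax bx)
outcome₄ = toWitness {a? = ∀-Bool? λ ab → ∀-Bool? λ ax → ∀-Bool? λ bx → Outcome? (⤖-id _) (graph₄ ab ax bx)} _

outcome₅ : ∀ ab ax ay bx by xy → Outcome relabelling₅ (graph₅ ab ax ay bx by xy)
outcome₅ = toWitness {a? = ∀-Bool? λ ab → ∀-Bool? λ ax → ∀-Bool? λ ay → ∀-Bool? λ bx → ∀-Bool? λ by →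
                           ∀-Bool? λ xy → Outcome? relabelling₅ (graph₅ ab ax ay bx by xy)} _

module SmallOrder {n : ℕ} {G : Graph n} (sp : IsSP G) (no-dominating : ∀ v → ¬ Dominates G v)
  (two-neighbours : ∀ v → TwoNeighbours G v)
  {p q r s : Fin n} (p≢q : p ≢ q) (p≢r : p ≢ r) (p≢s : p ≢ s) (q≢r : q ≢ r) (q≢s : q ≢ s) (r≢s : r ≢ s)
  {m : ℕ} {T : Graph m} (T≅G : T ≅ G) where

  open Chain G

  hypotheses : Hypotheses T
  hypotheses = (λ _ → no-dominating _ ∘ Transport.dominates-to T≅G)
             , (λ _ → Transport.two-neighbours-from T≅G (two-neighbours _))
             , Transport.IsSP-to (≅-sym T≅G) sp

  outcome⇒bound : ∀ φ → Outcome φ T → LSCC≡∞ G ⊎ LSCC≤ G 5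
  outcome⇒bound _ (inj₁ ¬hypotheses) = ⊥-elim (¬hypotheses hypotheses)
  outcome⇒bound _ (inj₂ (inj₁ ¬sp₁)) = chain-stops 1 4 (¬sp₁ ∘ Transport.IsSP-to (≅-sym (≅-iter T≅G 1)))
  outcome⇒bound _ (inj₂ (inj₂ (inj₁ (_ , dom₁)))) = chain-stops 3 2
    (dominating⇒not-SP 1 (Transport.dominates-to (≅-iter T≅G 1) dom₁) p≢q p≢r p≢s q≢r q≢s r≢s)
  outcome⇒bound _ (inj₂ (inj₂ (inj₂ (inj₁ (_ , dom₂))))) = chain-stops 4 1
    (dominating⇒not-SP 2 (Transport.dominates-to (≅-iter T≅G 2) dom₂) p≢q p≢r p≢s q≢r q≢s r≢s)
  outcome⇒bound φ (inj₂ (inj₂ (inj₂ (inj₂ T≅CG)))) = inj₂ (inj₁ (self-similar⇒all-isomorphic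
    (≅-trans (≅-sym T≅G) (≅-trans (mk≅ φ T≅CG) (≅-iter T≅G 1)))))

module DegreeTwoVertex {n : ℕ} {G : Graph n}
  (G-sym : ∀ u v → G u v ≡ G v u) (G-irrefl : ∀ v → G v v ≡ false)
  (sp : IsSP G) (no-dominating : ∀ v → ¬ Dominates G v) (two-neighbours : ∀ v → TwoNeighbours G v)
  {w a b : Fin n} (a≢b : a ≢ b) (wa : E G w a) (wb : E G w b) (only : ∀ {z} → E G w z → z ≡ a ⊎ z ≡ b) where

  open Chain G
  open IsCoalitionGraph

  Outer : Fin n → Set
  Outer z = ¬ OneOf w a b z

  Result : Set
  Result = LSCC≡∞ G ⊎ LSCC≤ G 5

  E-sym : ∀ {u v} → E G u v → E G v u
  E-sym {u} {v} e = trans (G-sym v u) e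

  E-irrefl : ∀ {v} → ¬ E G v v
  E-irrefl {v} e with trans (sym e) (G-irrefl v)
  ... | ()

  w≢a : w ≢ a
  w≢a refl = E-irrefl wa

  w≢b : w ≢ b
  w≢b refl = E-irrefl wb

  w≢ : ∀ {x} → Outer x → w ≢ x
  w≢ x-outer refl = x-outer (inj₁ refl)

  a≢ : ∀ {x} → Outer x → a ≢ x
  a≢ x-outer refl = x-outer (inj₂ (inj₁ refl))

  b≢ : ∀ {x} → Outer x → b ≢ x
  b≢ x-outer refl = x-outer (inj₂ (inj₂ refl))

  outer-not-adjacent : ∀ {x} → Outer x → ¬ E G w x
  outer-not-adjacent x-outer wx = x-outer (inj₂ (only wx))

  outer-vertex : ∃[ x ] Outer x
  outer-vertex with ¬∀⟶∃¬ n (Covers G w) (λ z → z ≟ w ⊎-dec E? G w z) (no-dominating w)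
  ... | x , ¬covered = x , λ where
    (inj₁ x≡w)        → ¬covered (inj₁ x≡w)
    (inj₂ (inj₁ refl)) → ¬covered (inj₂ wa)
    (inj₂ (inj₂ refl)) → ¬covered (inj₂ wb)

  -- A coalition must dominate w, so it meets N[w] = {w, a, b}.
  outer-not-allied : ∀ {x y} → Outer x → Outer y → ¬ Allied G x y
  outer-not-allied x-outer y-outer al with pair-dominates al w
  ... | inj₁ w≡x              = x-outer (inj₁ (sym w≡x))
  ... | inj₂ (inj₁ w≡y)       = y-outer (inj₁ (sym w≡y))
  ... | inj₂ (inj₂ (inj₁ xw)) = x-outer (inj₂ (only (E-sym xw)))
  ... | inj₂ (inj₂ (inj₂ yw)) = y-outer (inj₂ (only (E-sym yw)))

  outer-independent₁ : ∀ {x y} → Outer x → Outer y → ¬ E (iter 1 G) x y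
  outer-independent₁ x-outer y-outer = outer-not-allied x-outer y-outer ∘ edge⇒allied (iter-isCoalitionGraph 0)

  many-outer : ∀ {x y t} → Outer x → Outer y → Outer t → x ≢ y → x ≢ t → y ≢ t → Result
  many-outer x-outer y-outer t-outer x≢y x≢t y≢t = by-cases (IsSP? (iter 2 G)) (any? (Dominates? (iter 2 G)))
    where
    by-cases : Dec (IsSP (iter 2 G)) → Dec (∃[ v ] Dominates (iter 2 G) v) → Result
    by-cases (no ¬sp₂) _ = chain-stops 2 3 ¬sp₂
    by-cases (yes _) (yes (_ , dom)) = chain-stops 4 1
      (dominating⇒not-SP 2 dom w≢a w≢b (w≢ x-outer) a≢b (a≢ x-outer) (b≢ x-outer))
    by-cases (yes sp₂) (no ∄dom) = inj₁ (infinite , ¬all-isomorphic)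
      where
      ally : ∀ {z} → Outer z → ∃[ c ] Allied (iter 2 G) z c
      ally {z} _ = [ ⊥-elim ∘ ∄dom ∘ (z ,_) , id ]′ (IsSP⇒IsSP′ (iter 2 G) sp₂ z)

      open CompleteBipartiteCore (iter-isCoalitionGraph 1)
             (edge-sym (iter-isCoalitionGraph 0)) (edge-irrefl (iter-isCoalitionGraph 0)) w≢a w≢b a≢b x≢y x≢t y≢t
             x-outer y-outer t-outer outer-independent₁ (λ v dom → ∄dom (v , dom)) ally
        using (coalition-graph-fixed; every-vertex-three-neighbours)

      infinite : ChainInfinite G
      infinite = stationary⇒infinite sp (Transport.IsSP-to (≗⇒≅ coalition-graph-fixed) sp₂) coalition-graph-fixed

      ¬all-isomorphic : ¬ AllIsomorphic G
      ¬all-isomorphic = ¬self-similar⇒¬all-isomorphic sp λ G≅CG →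
        not-three-neighbours G only (Transport.three-neighbours-from G≅CG (every-vertex-three-neighbours _))

  core-member : ∀ {m z} {rest : Vec (Fin n) m} → OneOf w a b z → z ∈ᵥ (w ∷ a ∷ b ∷ rest)
  core-member (inj₁ z≡w)        = here z≡w
  core-member (inj₂ (inj₁ z≡a)) = there (here z≡a)
  core-member (inj₂ (inj₂ z≡b)) = there (there (here z≡b))

  adjacent : ∀ {u v} → E G u v → true ≡ G u v
  adjacent = sym

  non-adjacent : ∀ {u v} → ¬ E G u v → false ≡ G u v
  non-adjacent = sym ∘ ¬-not

  one-outer : ∀ {x} → Outer x → (∀ {z} → Outer z → z ≡ x) → Result
  one-outer {x} x-outer only-x = SmallOrder.outcome⇒bound sp no-dominating two-neighbours
    w≢a w≢b (w≢ x-outer) a≢b (a≢ x-outer) (b≢ x-outer) T≅G (⤖-id _) (outcome₄ (G a b) (G a x) (G b x))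
    where
    vertices = w ∷ a ∷ b ∷ x ∷ []
    cover : ∀ z → z ∈ᵥ vertices
    cover z with OneOf? w a b z
    ... | yes z∈     = core-member z∈
    ... | no z-outer = there (there (there (here (only-x z-outer))))
    unique : Unique vertices
    unique = (w≢a ∷ w≢b ∷ w≢ x-outer ∷ []) ∷ (a≢b ∷ a≢ x-outer ∷ []) ∷ (b≢ x-outer ∷ []) ∷ [] ∷ []
    ¬wx = outer-not-adjacent x-outer
    T≅G : graph₄ (G a b) (G a x) (G b x) ≅ G
    T≅G = mk≅ (enumeration vertices unique cover) λ where
      0F 0F → sym (G-irrefl w) ; 0F 1F → adjacent wa ; 0F 2F → adjacent wb ; 0F 3F → non-adjacent ¬wx
      1F 0F → adjacent (E-sym wa) ; 1F 1F → sym (G-irrefl a) ; 1F 2F → refl ; 1F 3F → refl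
      2F 0F → adjacent (E-sym wb) ; 2F 1F → G-sym a b ; 2F 2F → sym (G-irrefl b) ; 2F 3F → refl
      3F 0F → non-adjacent (¬wx ∘ E-sym) ; 3F 1F → G-sym a x ; 3F 2F → G-sym b x ; 3F 3F → sym (G-irrefl x)

  two-outer : ∀ {x y} → Outer x → Outer y → x ≢ y → (∀ {z} → Outer z → z ≡ x ⊎ z ≡ y) → Result
  two-outer {x} {y} x-outer y-outer x≢y only-xy = SmallOrder.outcome⇒bound sp no-dominating two-neighbours
    w≢a w≢b (w≢ x-outer) a≢b (a≢ x-outer) (b≢ x-outer) T≅G relabelling₅
    (outcome₅ (G a b) (G a x) (G a y) (G b x) (G b y) (G x y))
    where
    vertices = w ∷ a ∷ b ∷ x ∷ y ∷ []
    cover : ∀ z → z ∈ᵥ vertices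
    cover z with OneOf? w a b z
    ... | yes z∈     = core-member z∈
    ... | no z-outer = there (there (there ([ here , there ∘ here ]′ (only-xy z-outer))))
    unique : Unique vertices
    unique = (w≢a ∷ w≢b ∷ w≢ x-outer ∷ w≢ y-outer ∷ []) ∷ (a≢b ∷ a≢ x-outer ∷ a≢ y-outer ∷ []) ∷
             (b≢ x-outer ∷ b≢ y-outer ∷ []) ∷ (x≢y ∷ []) ∷ [] ∷ []
    ¬wx = outer-not-adjacent x-outer
    ¬wy = outer-not-adjacent y-outer
    T≅G : graph₅ (G a b) (G a x) (G a y) (G b x) (G b y) (G x y) ≅ G
    T≅G = mk≅ (enumeration vertices unique cover) λ where
      0F 0F → sym (G-irrefl w) ; 0F 1F → adjacent wa ; 0F 2F → adjacent wb
      0F 3F → non-adjacent ¬wx ; 0F 4F → non-adjacent ¬wy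
      1F 0F → adjacent (E-sym wa) ; 1F 1F → sym (G-irrefl a) ; 1F 2F → refl ; 1F 3F → refl ; 1F 4F → refl
      2F 0F → adjacent (E-sym wb) ; 2F 1F → G-sym a b ; 2F 2F → sym (G-irrefl b) ; 2F 3F → refl ; 2F 4F → refl
      3F 0F → non-adjacent (¬wx ∘ E-sym) ; 3F 1F → G-sym a x ; 3F 2F → G-sym b x ; 3F 3F → sym (G-irrefl x)
      3F 4F → refl
      4F 0F → non-adjacent (¬wy ∘ E-sym) ; 4F 1F → G-sym a y ; 4F 2F → G-sym b y ; 4F 3F → G-sym x y
      4F 4F → sym (G-irrefl y)

  bound : Result
  bound with outer-vertex
  ... | x , x-outer with any? (λ y → ¬? (OneOf? w a b y) ×-dec ¬? (x ≟ y))
  ...   | no ∄y = one-outer x-outer only-x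
    where
    only-x : ∀ {z} → Outer z → z ≡ x
    only-x {z} z-outer with z ≟ x
    ... | yes z≡x = z≡x
    ... | no z≢x  = ⊥-elim (∄y (z , z-outer , z≢x ∘ sym))
  ...   | yes (y , y-outer , x≢y) with any? (λ t → ¬? (OneOf? w a b t) ×-dec ¬? (x ≟ t) ×-dec ¬? (y ≟ t))
  ...     | yes (t , t-outer , x≢t , y≢t) = many-outer x-outer y-outer t-outer x≢y x≢t y≢t
  ...     | no ∄t = two-outer x-outer y-outer x≢y only-xy
    where
    only-xy : ∀ {z} → Outer z → z ≡ x ⊎ z ≡ y
    only-xy {z} z-outer with z ≟ x | z ≟ y
    ... | yes z≡x | _       = inj₁ z≡x
    ... | no _    | yes z≡y = inj₂ z≡y
    ... | no z≢x  | no z≢y  = ⊥-elim (∄t (z , z-outer , z≢x ∘ sym , z≢y ∘ sym))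

theorem12 : (n : ℕ) (G : Graph n) → IsSimple G → IsSP G → MinDegreeIs G 2
    → ¬ HasFullVertex G → LSCC≡∞ G ⊎ LSCC≤ G 5
theorem12 n G (G-sym , G-irrefl) sp (δ≥2 , w , deg-w≡2) no-full with degree-two⇒neighbourhood G deg-w≡2
... | a , b , a≢b , wa , wb , only =
  DegreeTwoVertex.bound G-sym G-irrefl sp no-dominating (two-neighbours G ∘ δ≥2) a≢b wa wb only
  where
  no-dominating : ∀ v → ¬ Dominates G v
  no-dominating v dom = no-full (v , Dominates⇒IsFull G dom)
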